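{- Fix integers $r,s\ge 1$. Then there exist a finite set $P$ of points in the plane in general position and a point $x\in P$ such that the graph $G_P(x)$ contains the complete bipartite graph $K_{r,s}$ as a subgraph.
   Context: An empty triangle of $P$ is a triangle with vertices in $P$ whose interior contains no point of $P$. The graph $G_P(x)$ has as vertex set the empty triangles of $P$ having $x$ as a vertex; two such triangles $T_1,T_2$ are adjacent if and only if (i) they share an edge, (ii) they have disjoint interiors, and (iii) the sum of the angles of $T_1$ and $T_2$ at the vertex $x$ exceeds $180^\circ$. -}

module Defs where

open import Data.Nat using (ℕ; suc)
open import Data.Integer using (ℤ; +_; _+_; _-_; _*_; _<_; _≤_; 0ℤ)
open import Data.Fin using (Fin)
open import Data.Product using (_×_; Σ; ∃; _,_; proj₁; proj₂)
open import Data.Sum using (_⊎_)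
open import Relation.Binary.PropositionalEquality using (_≡_; _≢_)
open import Relation.Nullary using (¬_)
open import Function.Definitions using (Injective)

Point : Set
Point = ℤ × ℤ

px py : Point → ℤ
px = proj₁
py = proj₂

-- Rational points (X / (1+w), Y / (1+w)); used to quantify over points of the
-- plane when speaking about interiors (open sets: meeting ⇔ meeting in ℚ²).
record RatPoint : Set where
  constructor rat
  field
    X Y : ℤ
    w   : ℕ

den : RatPoint → ℤ
den q = + suc (RatPoint.w q)

embed : Point → RatPoint
embed p = rat (px p) (py p) 0

-- (1+w) times the orientation determinant of (a, b, q)
orientR : Point → Point → RatPoint → ℤ
orientR a b q =
  (px b - px a) * (RatPoint.Y q - den q * py a)
  - (py b - py a) * (RatPoint.X q - den q * px a)

orient : Point → Point → Point → ℤ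
orient o a b = (px a - px o) * (py b - py o) - (py a - py o) * (px b - px o)

dot : Point → Point → Point → ℤ
dot o a b = (px a - px o) * (px b - px o) + (py a - py o) * (py b - py o)

sqd : Point → Point → ℤ
sqd o a = dot o a a

Triangle : Set
Triangle = Point × Point × Point

IsVertex : Point → Triangle → Set
IsVertex p (a , b , c) = p ≡ a ⊎ p ≡ b ⊎ p ≡ c

SameTriangle : Triangle → Triangle → Set
SameTriangle T₁ T₂ = (∀ p → IsVertex p T₁ → IsVertex p T₂) × (∀ p → IsVertex p T₂ → IsVertex p T₁)

InInterior : Triangle → RatPoint → Set
InInterior (a , b , c) q =
  (0ℤ < orientR a b q × 0ℤ < orientR b c q × 0ℤ < orientR c a q)
  ⊎ (orientR a b q < 0ℤ × orientR b c q < 0ℤ × orientR c a q < 0ℤ)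

-- A finite point set P = {P 0, …, P (n-1)} (P injective).
-- Empty triangle of P: no point of P in its interior.
EmptyIn : ∀ {n} → (Fin n → Point) → Triangle → Set
EmptyIn P T = ∀ i → ¬ InInterior T (embed (P i))

GeneralPosition : ∀ {n} → (Fin n → Point) → Set
GeneralPosition P = ∀ i j k → i ≢ j → j ≢ k → i ≢ k → orient (P i) (P j) (P k) ≢ 0ℤ

ShareEdge : Triangle → Triangle → Set
ShareEdge T₁ T₂ = Σ Point λ u → Σ Point λ v →
  u ≢ v × IsVertex u T₁ × IsVertex v T₁ × IsVertex u T₂ × IsVertex v T₂

DisjointInteriors : Triangle → Triangle → Set
DisjointInteriors T₁ T₂ = ∀ q → ¬ (InInterior T₁ q × InInterior T₂ q)

-- For reals u, v with u = p·√U, v = q·√V (U, V > 0): u + v < 0.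
SumNeg : ℤ → ℤ → ℤ → ℤ → Set
SumNeg p U q V =
  (p < 0ℤ × q ≤ 0ℤ) ⊎ (p ≤ 0ℤ × q < 0ℤ)
  ⊎ (p < 0ℤ × 0ℤ < q × q * q * V < p * p * U)
  ⊎ (q < 0ℤ × 0ℤ < p × p * p * U < q * q * V)

-- ∠axb + ∠cxd > 180°.  With α = ∠axb, γ = ∠cxd ∈ [0,π]:
-- α + γ > π ⇔ cos γ < cos(π − α) ⇔ cos α + cos γ < 0 ⇔
-- (xa·xb)·|xc||xd| + (xc·xd)·|xa||xb| < 0.
AngleSumExceedsπ : Point → Point → Point → Point → Point → Set
AngleSumExceedsπ x a b c d =
  SumNeg (dot x a b) (sqd x c * sqd x d) (dot x c d) (sqd x a * sqd x b)

tri : Point → Point → Point → Triangle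
tri x a b = (x , a , b)

IsGVertex : ∀ {n} → (Fin n → Point) → Fin n → Fin n × Fin n → Set
IsGVertex P ix (j , k) = ix ≢ j × ix ≢ k × j ≢ k × EmptyIn P (tri (P ix) (P j) (P k))

Adjacent : ∀ {n} → (Fin n → Point) → Fin n → Fin n × Fin n → Fin n × Fin n → Set
Adjacent P ix (j , k) (j' , k') =
  ShareEdge (tri (P ix) (P j) (P k)) (tri (P ix) (P j') (P k'))
  × DisjointInteriors (tri (P ix) (P j) (P k)) (tri (P ix) (P j') (P k'))
  × AngleSumExceedsπ (P ix) (P j) (P k) (P j') (P k')

toTri : ∀ {n} → (Fin n → Point) → Fin n → Fin n × Fin n → Triangle
toTri P ix (j , k) = tri (P ix) (P j) (P k)

ContainsKrs : ∀ {n} → (Fin n → Point) → Fin n → ℕ → ℕ → Set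
ContainsKrs {n} P ix r s =
  Σ (Fin r → Fin n × Fin n) λ f → Σ (Fin s → Fin n × Fin n) λ g →
    (∀ i → IsGVertex P ix (f i)) × (∀ j → IsGVertex P ix (g j))
    × (∀ i i' → i ≢ i' → ¬ SameTriangle (toTri P ix (f i)) (toTri P ix (f i')))
    × (∀ j j' → j ≢ j' → ¬ SameTriangle (toTri P ix (g j)) (toTri P ix (g j')))
    × (∀ i j → ¬ SameTriangle (toTri P ix (f i)) (toTri P ix (g j)))
    × (∀ i j → Adjacent P ix (f i) (g j))

{-# OPTIONS --safe #-}
module Submission where

-- Put x at the inflection point of the cubic y = t³ and the other points at pt t = (t, t³),
-- where orient (pt u) (pt v) (pt w) = (v − u)(w − u)(w − v)(u + v + w). Let a = pt A with A > 0
-- and give all remaining points negative parameters t. Every angle ∠a x (pt t) is obtuse, the dot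
-- product being A·t·(1 + A²t²) < 0, and the triangle x a (pt t) lies on the side of the line xa
-- given by the sign of A + t. If any two negative parameters sum to less than −A, every other curve
-- point pt t′ is cut off from the triangle x a (pt t) by its edge a (pt t) or by its edge (pt t) x,
-- so all these triangles are empty. Taking r parameters in (−A, −A/2) and s below −A gives r
-- triangles on one side of xa and s on the other, each of the former adjacent to each of the latter.

open import Defs
open import Data.Nat as ℕ using (ℕ; _≥_; zero; suc; s≤s; z≤n)
import Data.Nat.Properties as ℕ
open import Data.Integer using (ℤ; +_; -[1+_]; +[1+_]; 0ℤ; _+_; _-_; _*_; -_; _<_; +<+; -<+; -<-)
import Data.Integer.Properties as ℤ
open import Data.Integer.Tactic.RingSolver using (solve-∀)
open import Data.Fin as Fin using (Fin; zero; suc; toℕ; _↑ˡ_; _↑ʳ_)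
import Data.Fin.Properties as Fin
open import Data.Product using (Σ; _×_; _,_; proj₁; proj₂)
open import Data.Sum as Sum using (inj₁; inj₂; _⊎_)
open import Data.Empty using (⊥-elim)
open import Function using (_∘_)
open import Function.Definitions using (Injective)
open import Relation.Nullary using (¬_; yes; no)
open import Relation.Binary.Definitions using (tri<; tri≈; tri>)
open import Relation.Binary.PropositionalEquality
  using (_≡_; _≢_; refl; sym; trans; cong; subst; subst₂)

pos*pos>0 : ∀ {i j} → 0ℤ < i → 0ℤ < j → 0ℤ < i * j
pos*pos>0 (+<+ (s≤s _)) (+<+ (s≤s _)) = +<+ (s≤s z≤n)

pos*neg<0 : ∀ {i j} → 0ℤ < i → j < 0ℤ → i * j < 0ℤ
pos*neg<0 (+<+ (s≤s _)) -<+ = -<+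

neg*neg>0 : ∀ {i j} → i < 0ℤ → j < 0ℤ → 0ℤ < i * j
neg*neg>0 -<+ -<+ = +<+ (s≤s z≤n)

i<j⇒0<j-i : ∀ {i j} → i < j → 0ℤ < j - i
i<j⇒0<j-i {i} {j} i<j = subst (_< j - i) (ℤ.+-inverseʳ i) (ℤ.+-monoˡ-< (- i) i<j)

i<j⇒i-j<0 : ∀ {i j} → i < j → i - j < 0ℤ
i<j⇒i-j<0 {i} {j} i<j = subst (i - j <_) (ℤ.+-inverseʳ j) (ℤ.+-monoˡ-< (- j) i<j)

-i<j⇒0<i+j : ∀ {i j} → - i < j → 0ℤ < i + j
-i<j⇒0<i+j {i} {j} -i<j = subst (_< i + j) (ℤ.+-inverseʳ i) (ℤ.+-monoʳ-< i -i<j)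

j<-i⇒i+j<0 : ∀ {i j} → j < - i → i + j < 0ℤ
j<-i⇒i+j<0 {i} {j} j<-i = subst (i + j <_) (ℤ.+-inverseʳ i) (ℤ.+-monoʳ-< i j<-i)

<0⇒≢0 : ∀ {i} → i < 0ℤ → i ≢ 0ℤ
<0⇒≢0 i<0 i≡0 = ℤ.<-irrefl i≡0 i<0

>0⇒≢0 : ∀ {i} → 0ℤ < i → i ≢ 0ℤ
>0⇒≢0 0<i i≡0 = ℤ.<-irrefl (sym i≡0) 0<i

SignsDiffer : ℤ → ℤ → Set
SignsDiffer i j = (i < 0ℤ × 0ℤ < j) ⊎ (0ℤ < i × j < 0ℤ)

orient-rotate : ∀ a b c → orient a b c ≡ orient b c a
orient-rotate (ax , ay) (bx , by) (cx , cy) = ring ax ay bx by cx cy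
  where
  ring : ∀ ax ay bx by cx cy →
    (bx - ax) * (cy - ay) - (by - ay) * (cx - ax) ≡ (cx - bx) * (ay - by) - (cy - by) * (ax - bx)
  ring = solve-∀

orient-aba≡0 : ∀ a b → orient a b a ≡ 0ℤ
orient-aba≡0 (ax , ay) (bx , by) = ring ax ay bx by
  where
  ring : ∀ ax ay bx by → (bx - ax) * (ay - ay) - (by - ay) * (ax - ax) ≡ 0ℤ
  ring = solve-∀

orient-abb≡0 : ∀ a b → orient a b b ≡ 0ℤ
orient-abb≡0 (ax , ay) (bx , by) = ring ax ay bx by
  where
  ring : ∀ ax ay bx by → (bx - ax) * (by - ay) - (by - ay) * (bx - ax) ≡ 0ℤ
  ring = solve-∀

orientR-embed : ∀ a b c → orientR a b (embed c) ≡ orient a b c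
orientR-embed (ax , ay) (bx , by) (cx , cy) = ring ax ay bx by cx cy
  where
  ring : ∀ ax ay bx by cx cy →
    (bx - ax) * (cy - + 1 * ay) - (by - ay) * (cx - + 1 * ax) ≡ (bx - ax) * (cy - ay) - (by - ay) * (cx - ax)
  ring = solve-∀

orientR-sum : ∀ a b c q → orientR a b q + orientR b c q + orientR c a q ≡ den q * orient a b c
orientR-sum (ax , ay) (bx , by) (cx , cy) (rat X Y w) = ring ax ay bx by cx cy X Y (+ suc w)
  where
  ring : ∀ ax ay bx by cx cy X Y d →
    (bx - ax) * (Y - d * ay) - (by - ay) * (X - d * ax)
    + ((cx - bx) * (Y - d * by) - (cy - by) * (X - d * bx))
    + ((ax - cx) * (Y - d * cy) - (ay - cy) * (X - d * cx))
    ≡ d * ((bx - ax) * (cy - ay) - (by - ay) * (cx - ax))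
  ring = solve-∀

den>0 : ∀ q → 0ℤ < den q
den>0 _ = +<+ (s≤s z≤n)

interior⇒orientR>0 : ∀ {a b c q} → 0ℤ < orient a b c → InInterior (a , b , c) q → 0ℤ < orientR a b q
interior⇒orientR>0 _ (inj₁ (0<ab , _)) = 0<ab
interior⇒orientR>0 {a} {b} {c} {q} 0<abc (inj₂ (ab<0 , bc<0 , ca<0)) =
  ⊥-elim (ℤ.<-asym (ℤ.+-mono-< (ℤ.+-mono-< ab<0 bc<0) ca<0)
                   (subst (0ℤ <_) (sym (orientR-sum a b c q)) (pos*pos>0 (den>0 q) 0<abc)))

interior⇒orientR<0 : ∀ {a b c q} → orient a b c < 0ℤ → InInterior (a , b , c) q → orientR a b q < 0ℤ
interior⇒orientR<0 _ (inj₂ (ab<0 , _)) = ab<0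
interior⇒orientR<0 {a} {b} {c} {q} abc<0 (inj₁ (0<ab , 0<bc , 0<ca)) =
  ⊥-elim (ℤ.<-asym (subst (_< 0ℤ) (sym (orientR-sum a b c q)) (pos*neg<0 (den>0 q) abc<0))
                   (ℤ.+-mono-< (ℤ.+-mono-< 0<ab 0<bc) 0<ca))

opposite-sides⇒disjointInteriors : ∀ {a b c d} → 0ℤ < orient a b c → orient a b d < 0ℤ →
  DisjointInteriors (a , b , c) (a , b , d)
opposite-sides⇒disjointInteriors {a} {b} {c} {d} 0<abc abd<0 q (inC , inD) =
  ℤ.<-asym (interior⇒orientR>0 {a} {b} {c} {q} 0<abc inC) (interior⇒orientR<0 {a} {b} {d} {q} abd<0 inD)

interior⇒orientR≢0 : ∀ {a b c q} → InInterior (a , b , c) q →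
  orientR a b q ≢ 0ℤ × orientR b c q ≢ 0ℤ
interior⇒orientR≢0 (inj₁ (0<ab , 0<bc , _)) = >0⇒≢0 0<ab , >0⇒≢0 0<bc
interior⇒orientR≢0 (inj₂ (ab<0 , bc<0 , _)) = <0⇒≢0 ab<0 , <0⇒≢0 bc<0

vertex∉interior : ∀ {a b c p} → IsVertex p (a , b , c) → ¬ InInterior (a , b , c) (embed p)
vertex∉interior {a} {b} {c} (inj₁ refl) I =
  proj₁ (interior⇒orientR≢0 {a} {b} {c} {embed a} I) (trans (orientR-embed a b a) (orient-aba≡0 a b))
vertex∉interior {a} {b} {c} (inj₂ (inj₁ refl)) I =
  proj₁ (interior⇒orientR≢0 {a} {b} {c} {embed b} I) (trans (orientR-embed a b b) (orient-abb≡0 a b))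
vertex∉interior {a} {b} {c} (inj₂ (inj₂ refl)) I =
  proj₂ (interior⇒orientR≢0 {a} {b} {c} {embed c} I) (trans (orientR-embed b c c) (orient-abb≡0 b c))

orientR-signsDiffer⇒∉interior : ∀ {a b c q} → SignsDiffer (orientR b c q) (orientR c a q) →
  ¬ InInterior (a , b , c) q
orientR-signsDiffer⇒∉interior (inj₁ (bc<0 , _))   (inj₁ (_ , 0<bc , _)) = ℤ.<-asym bc<0 0<bc
orientR-signsDiffer⇒∉interior (inj₁ (_ , 0<ca))   (inj₂ (_ , _ , ca<0)) = ℤ.<-asym ca<0 0<ca
orientR-signsDiffer⇒∉interior (inj₂ (_ , ca<0))   (inj₁ (_ , _ , 0<ca)) = ℤ.<-asym ca<0 0<ca
orientR-signsDiffer⇒∉interior (inj₂ (0<bc , _))   (inj₂ (_ , bc<0 , _)) = ℤ.<-asym bc<0 0<bc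

signsDiffer⇒∉interior : ∀ {a b c p} → SignsDiffer (orient b c p) (orient c a p) →
  ¬ InInterior (a , b , c) (embed p)
signsDiffer⇒∉interior {a} {b} {c} {p} differ =
  orientR-signsDiffer⇒∉interior {a} {b} {c} {embed p}
    (subst₂ SignsDiffer (sym (orientR-embed b c p)) (sym (orientR-embed c a p)) differ)

third∉⇒¬sameTriangle : ∀ {x a c d} → c ≢ x → c ≢ a → c ≢ d →
  ¬ SameTriangle (tri x a c) (tri x a d)
third∉⇒¬sameTriangle {c = c} c≢x c≢a c≢d (vertices⊆ , _) with vertices⊆ c (inj₂ (inj₂ refl))
... | inj₁ c≡x          = c≢x c≡x
... | inj₂ (inj₁ c≡a)   = c≢a c≡a
... | inj₂ (inj₂ c≡d)   = c≢d c≡d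

commonEdge : ∀ {x a b c} → x ≢ a → ShareEdge (tri x a b) (tri x a c)
commonEdge {x} {a} x≢a = x , a , x≢a , inj₁ refl , inj₂ (inj₁ refl) , inj₁ refl , inj₂ (inj₁ refl)

obtuse+obtuse>π : ∀ {x a b c d} → dot x a b < 0ℤ → dot x c d < 0ℤ → AngleSumExceedsπ x a b c d
obtuse+obtuse>π xab<0 xcd<0 = inj₁ (xab<0 , ℤ.<⇒≤ xcd<0)

adjacent-across-edge : ∀ {n} {P : Fin n → Point} {x a k l} → P x ≢ P a →
  0ℤ < orient (P x) (P a) (P k) → orient (P x) (P a) (P l) < 0ℤ →
  dot (P x) (P a) (P k) < 0ℤ → dot (P x) (P a) (P l) < 0ℤ → Adjacent P x (a , k) (a , l)
adjacent-across-edge {P = P} {x} {a} {k} {l} x≢a 0<xak xal<0 obtuse-k obtuse-l =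
  commonEdge {P x} {P a} {P k} {P l} x≢a ,
  opposite-sides⇒disjointInteriors {P x} {P a} {P k} {P l} 0<xak xal<0 ,
  obtuse+obtuse>π {P x} {P a} {P k} {P a} {P l} obtuse-k obtuse-l

pt : ℤ → Point
pt t = t , t * t * t

pt-injective : ∀ {u v} → pt u ≡ pt v → u ≡ v
pt-injective = cong proj₁

orient-pt : ∀ u v w → orient (pt u) (pt v) (pt w) ≡ (v - u) * (w - u) * (w - v) * (u + v + w)
orient-pt = ring
  where
  ring : ∀ u v w → (v - u) * (w * w * w - u * u * u) - (v * v * v - u * u * u) * (w - u)
                   ≡ (v - u) * (w - u) * (w - v) * (u + v + w)
  ring = solve-∀

orient-pt-origin : ∀ u v → orient (pt 0ℤ) (pt u) (pt v) ≡ u * v * (v - u) * (u + v)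
orient-pt-origin = ring
  where
  ring : ∀ u v → (u - 0ℤ) * (v * v * v - 0ℤ * 0ℤ * 0ℤ) - (u * u * u - 0ℤ * 0ℤ * 0ℤ) * (v - 0ℤ)
                 ≡ u * v * (v - u) * (u + v)
  ring = solve-∀

dot-pt-origin : ∀ u v → dot (pt 0ℤ) (pt u) (pt v) ≡ u * v + u * v * (u * v) * (u * v)
dot-pt-origin = ring
  where
  ring : ∀ u v → (u - 0ℤ) * (v - 0ℤ) + (u * u * u - 0ℤ * 0ℤ * 0ℤ) * (v * v * v - 0ℤ * 0ℤ * 0ℤ)
                 ≡ u * v + u * v * (u * v) * (u * v)
  ring = solve-∀

dot-pt-origin<0 : ∀ {u v} → u * v < 0ℤ → dot (pt 0ℤ) (pt u) (pt v) < 0ℤ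
dot-pt-origin<0 {u} {v} uv<0 =
  subst (_< 0ℤ) (sym (dot-pt-origin u v)) (ℤ.+-mono-< uv<0 (pos*neg<0 (neg*neg>0 uv<0 uv<0) uv<0))

*-zero-factor₄ : ∀ a b c d → a * b * c * d ≡ 0ℤ → a ≡ 0ℤ ⊎ b ≡ 0ℤ ⊎ c ≡ 0ℤ ⊎ d ≡ 0ℤ
*-zero-factor₄ a b c d abcd≡0 with ℤ.i*j≡0⇒i≡0∨j≡0 (a * b * c) abcd≡0
... | inj₂ d≡0 = inj₂ (inj₂ (inj₂ d≡0))
... | inj₁ abc≡0 with ℤ.i*j≡0⇒i≡0∨j≡0 (a * b) abc≡0
...   | inj₂ c≡0 = inj₂ (inj₂ (inj₁ c≡0))
...   | inj₁ ab≡0 with ℤ.i*j≡0⇒i≡0∨j≡0 a ab≡0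
...     | inj₁ a≡0 = inj₁ a≡0
...     | inj₂ b≡0 = inj₂ (inj₁ b≡0)

pt-collinear : ∀ u v w → orient (pt u) (pt v) (pt w) ≡ 0ℤ →
  u ≡ v ⊎ u ≡ w ⊎ v ≡ w ⊎ u + v + w ≡ 0ℤ
pt-collinear u v w collinear =
  Sum.map (sym ∘ ℤ.i-j≡0⇒i≡j v u)
    (Sum.map (sym ∘ ℤ.i-j≡0⇒i≡j w u) (Sum.map₁ (sym ∘ ℤ.i-j≡0⇒i≡j w v)))
    (*-zero-factor₄ (v - u) (w - u) (w - v) (u + v + w) (trans (sym (orient-pt u v w)) collinear))

pt-generalPosition : ∀ {n} {f : Fin n → ℤ} → Injective _≡_ _≡_ f →
  (∀ i j k → i ≢ j → j ≢ k → i ≢ k → f i + f j + f k ≢ 0ℤ) → GeneralPosition (pt ∘ f)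
pt-generalPosition {f = f} f-injective sum≢0 i j k i≢j j≢k i≢k collinear =
  Sum.[ i≢j ∘ f-injective ,
  Sum.[ i≢k ∘ f-injective ,
  Sum.[ j≢k ∘ f-injective , sum≢0 i j k i≢j j≢k i≢k ] ] ]
    (pt-collinear (f i) (f j) (f k) collinear)

pt-signsDiffer : ∀ {A t t′} → 0ℤ < A → t < 0ℤ → t′ < 0ℤ → t + t′ < - A → t ≢ t′ →
  SignsDiffer (orient (pt A) (pt t) (pt t′)) (orient (pt t) (pt 0ℤ) (pt t′))
pt-signsDiffer {A} {t} {t′} 0<A t<0 t′<0 t+t′<-A t≢t′ =
  subst₂ SignsDiffer (sym (orient-pt A t t′))
         (sym (trans (orient-rotate (pt t) (pt 0ℤ) (pt t′)) (orient-pt-origin t′ t)))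
         by-order
  where
  0<[t-A][t′-A] : 0ℤ < (t - A) * (t′ - A)
  0<[t-A][t′-A] = neg*neg>0 (i<j⇒i-j<0 (ℤ.<-trans t<0 0<A)) (i<j⇒i-j<0 (ℤ.<-trans t′<0 0<A))

  A+t+t′<0 : A + t + t′ < 0ℤ
  A+t+t′<0 = subst (_< 0ℤ) (sym (ℤ.+-assoc A t t′)) (j<-i⇒i+j<0 t+t′<-A)

  0<t′t : 0ℤ < t′ * t
  0<t′t = neg*neg>0 t′<0 t<0

  t′+t<0 : t′ + t < 0ℤ
  t′+t<0 = ℤ.+-mono-< t′<0 t<0

  by-order : SignsDiffer ((t - A) * (t′ - A) * (t′ - t) * (A + t + t′)) (t′ * t * (t - t′) * (t′ + t))
  by-order with ℤ.<-cmp t t′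
  ... | tri< t<t′ _ _ = inj₁ ( pos*neg<0 (pos*pos>0 0<[t-A][t′-A] (i<j⇒0<j-i t<t′)) A+t+t′<0
                             , neg*neg>0 (pos*neg<0 0<t′t (i<j⇒i-j<0 t<t′)) t′+t<0 )
  ... | tri≈ _ t≡t′ _ = ⊥-elim (t≢t′ t≡t′)
  ... | tri> _ _ t′<t = inj₂ ( neg*neg>0 (pos*neg<0 0<[t-A][t′-A] (i<j⇒i-j<0 t′<t)) A+t+t′<0
                             , pos*neg<0 (pos*pos>0 0<t′t (i<j⇒0<j-i t′<t)) t′+t<0 )

sum-swap₁₂ : ∀ x y z → x + y + z ≡ y + x + z
sum-swap₁₂ = solve-∀

sum-swap₂₃ : ∀ x y z → x + y + z ≡ x + z + y
sum-swap₂₃ = solve-∀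

sum-rotate : ∀ x y z → x + y + z ≡ z + x + y
sum-rotate = solve-∀

module _ {n} (f : Fin n → ℤ) (sorted : ∀ {i j k} → i Fin.< j → j Fin.< k → f i + f j + f k ≢ 0ℤ) where

  private
    insert : ∀ {i j} k → i Fin.< j → j ≢ k → i ≢ k → f i + f j + f k ≢ 0ℤ
    insert {i} {j} k i<j j≢k i≢k with Fin.<-cmp j k | Fin.<-cmp i k
    ... | tri< j<k _ _ | _            = sorted i<j j<k
    ... | tri≈ _ j≡k _ | _            = ⊥-elim (j≢k j≡k)
    ... | tri> _ _ k<j | tri< i<k _ _ = subst (_≢ 0ℤ) (sum-swap₂₃ (f i) (f k) (f j)) (sorted i<k k<j)
    ... | tri> _ _ k<j | tri≈ _ i≡k _ = ⊥-elim (i≢k i≡k)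
    ... | tri> _ _ k<j | tri> _ _ k<i = subst (_≢ 0ℤ) (sym (sum-rotate (f i) (f j) (f k))) (sorted k<i i<j)

  sortedSums≢0⇒distinctSums≢0 : ∀ i j k → i ≢ j → j ≢ k → i ≢ k → f i + f j + f k ≢ 0ℤ
  sortedSums≢0⇒distinctSums≢0 i j k i≢j j≢k i≢k with Fin.<-cmp i j
  ... | tri< i<j _ _ = insert k i<j j≢k i≢k
  ... | tri≈ _ i≡j _ = ⊥-elim (i≢j i≡j)
  ... | tri> _ _ j<i = subst (_≢ 0ℤ) (sum-swap₁₂ (f j) (f i) (f k)) (insert k j<i i≢k j≢k)

module Fan {m : ℕ} (A : ℤ) (t : Fin m → ℤ)
  (0<A : 0ℤ < A) (t<0 : ∀ k → t k < 0ℤ) (t-injective : Injective _≡_ _≡_ t)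
  (t+t<-A : ∀ k l → t k + t l < - A) (sides : ∀ k → - A < t k ⊎ t k < - A) where

  param : Fin (2 ℕ.+ m) → ℤ
  param zero          = 0ℤ
  param (suc zero)    = A
  param (suc (suc k)) = t k

  P : Fin (2 ℕ.+ m) → Point
  P = pt ∘ param

  param-injective : Injective _≡_ _≡_ param
  param-injective {zero}        {zero}        _    = refl
  param-injective {zero}        {suc zero}    0≡A  = ⊥-elim (>0⇒≢0 0<A (sym 0≡A))
  param-injective {zero}        {suc (suc l)} 0≡t  = ⊥-elim (<0⇒≢0 (t<0 l) (sym 0≡t))
  param-injective {suc zero}    {zero}        A≡0  = ⊥-elim (>0⇒≢0 0<A A≡0)
  param-injective {suc zero}    {suc zero}    _    = refl
  param-injective {suc zero}    {suc (suc l)} A≡t  =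
    ⊥-elim (ℤ.<-asym (t<0 l) (subst (0ℤ <_) A≡t 0<A))
  param-injective {suc (suc k)} {zero}        t≡0  = ⊥-elim (<0⇒≢0 (t<0 k) t≡0)
  param-injective {suc (suc k)} {suc zero}    t≡A  =
    ⊥-elim (ℤ.<-asym (t<0 k) (subst (0ℤ <_) (sym t≡A) 0<A))
  param-injective {suc (suc k)} {suc (suc l)} t≡t′ = cong (Fin.suc ∘ Fin.suc) (t-injective t≡t′)

  P-injective : Injective _≡_ _≡_ P
  P-injective = param-injective ∘ pt-injective

  A+t≢0 : ∀ k → A + t k ≢ 0ℤ
  A+t≢0 k with sides k
  ... | inj₁ -A<t = >0⇒≢0 (-i<j⇒0<i+j -A<t)
  ... | inj₂ t<-A = <0⇒≢0 (j<-i⇒i+j<0 t<-A)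

  sortedSum≢0 : ∀ {i j k} → i Fin.< j → j Fin.< k → param i + param j + param k ≢ 0ℤ
  sortedSum≢0 {zero} {suc zero} {suc (suc k)} _ _ =
    subst (_≢ 0ℤ) (cong (_+ t k) (sym (ℤ.+-identityˡ A))) (A+t≢0 k)
  sortedSum≢0 {zero} {suc (suc j)} {suc (suc k)} _ _ =
    <0⇒≢0 (ℤ.+-mono-< (ℤ.+-mono-≤-< (ℤ.≤-refl {0ℤ}) (t<0 j)) (t<0 k))
  sortedSum≢0 {suc zero} {suc (suc j)} {suc (suc k)} _ _ =
    <0⇒≢0 (subst (_< 0ℤ) (sym (ℤ.+-assoc A (t j) (t k))) (j<-i⇒i+j<0 (t+t<-A j k)))
  sortedSum≢0 {suc (suc i)} {suc (suc j)} {suc (suc k)} _ _ =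
    <0⇒≢0 (ℤ.+-mono-< (ℤ.+-mono-< (t<0 i) (t<0 j)) (t<0 k))
  sortedSum≢0 {_}           {suc zero}    {suc zero}    _        (s≤s ())
  sortedSum≢0 {_}           {suc (suc _)} {suc zero}    _        (s≤s ())
  sortedSum≢0 {suc zero}    {suc zero}    {suc (suc _)} (s≤s ()) _
  sortedSum≢0 {suc (suc _)} {suc zero}    {suc (suc _)} (s≤s ()) _

  P-generalPosition : GeneralPosition P
  P-generalPosition = pt-generalPosition param-injective (sortedSums≢0⇒distinctSums≢0 param sortedSum≢0)

  fanTriangle : Fin m → Fin (2 ℕ.+ m) × Fin (2 ℕ.+ m)
  fanTriangle k = suc zero , suc (suc k)

  t<A : ∀ k → t k < A
  t<A k = ℤ.<-trans (t<0 k) 0<A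

  orient-fan>0 : ∀ {k} → - A < t k → 0ℤ < orient (P zero) (P (suc zero)) (P (suc (suc k)))
  orient-fan>0 {k} -A<t = subst (0ℤ <_) (sym (orient-pt-origin A (t k)))
    (pos*pos>0 (neg*neg>0 (pos*neg<0 0<A (t<0 k)) (i<j⇒i-j<0 (t<A k))) (-i<j⇒0<i+j -A<t))

  orient-fan<0 : ∀ {k} → t k < - A → orient (P zero) (P (suc zero)) (P (suc (suc k))) < 0ℤ
  orient-fan<0 {k} t<-A = subst (_< 0ℤ) (sym (orient-pt-origin A (t k)))
    (pos*neg<0 (neg*neg>0 (pos*neg<0 0<A (t<0 k)) (i<j⇒i-j<0 (t<A k))) (j<-i⇒i+j<0 t<-A))

  dot-fan<0 : ∀ k → dot (P zero) (P (suc zero)) (P (suc (suc k))) < 0ℤ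
  dot-fan<0 k = dot-pt-origin<0 {A} {t k} (pos*neg<0 0<A (t<0 k))

  fan-empty : ∀ k → EmptyIn P (toTri P zero (fanTriangle k))
  fan-empty k zero = vertex∉interior {pt 0ℤ} {pt A} {pt (t k)} {pt 0ℤ} (inj₁ refl)
  fan-empty k (suc zero) = vertex∉interior {pt 0ℤ} {pt A} {pt (t k)} {pt A} (inj₂ (inj₁ refl))
  fan-empty k (suc (suc l)) with t k ℤ.≟ t l
  ... | yes tk≡tl = vertex∉interior {pt 0ℤ} {pt A} {pt (t k)} {pt (t l)}
                      (inj₂ (inj₂ (cong pt (sym tk≡tl))))
  ... | no tk≢tl  = signsDiffer⇒∉interior {pt 0ℤ} {pt A} {pt (t k)} {pt (t l)}
                      (pt-signsDiffer 0<A (t<0 k) (t<0 l) (t+t<-A k l) tk≢tl)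

  fan-isGVertex : ∀ k → IsGVertex P zero (fanTriangle k)
  fan-isGVertex k = (λ ()) , (λ ()) , (λ ()) , fan-empty k

  fan-distinct : ∀ {k l} → k ≢ l →
    ¬ SameTriangle (toTri P zero (fanTriangle k)) (toTri P zero (fanTriangle l))
  fan-distinct {k} {l} k≢l =
    third∉⇒¬sameTriangle {P zero} {P (suc zero)} {P (suc (suc k))} {P (suc (suc l))}
    (λ e → Fin.0≢1+n (sym (P-injective {suc (suc k)} {zero} e)))
    (λ e → Fin.0≢1+n (sym (Fin.suc-injective (P-injective {suc (suc k)} {suc zero} e))))
    (λ e → k≢l (Fin.suc-injective (Fin.suc-injective (P-injective {suc (suc k)} {suc (suc l)} e))))

  fan-adjacent : ∀ {k l} → - A < t k → t l < - A → Adjacent P zero (fanTriangle k) (fanTriangle l)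
  fan-adjacent {k} {l} -A<tk tl<-A =
    adjacent-across-edge {P = P} {zero} {suc zero} {suc (suc k)} {suc (suc l)}
      (λ e → Fin.0≢1+n (P-injective {zero} {suc zero} e))
      (orient-fan>0 -A<tk) (orient-fan<0 tl<-A) (dot-fan<0 k) (dot-fan<0 l)

  fan-containsKrs : ∀ {r s} (f : Fin r → Fin m) (g : Fin s → Fin m) →
    Injective _≡_ _≡_ f → Injective _≡_ _≡_ g →
    (∀ i → - A < t (f i)) → (∀ j → t (g j) < - A) → ContainsKrs P zero r s
  fan-containsKrs f g f-injective g-injective left right =
    fanTriangle ∘ f , fanTriangle ∘ g ,
    (λ i → fan-isGVertex (f i)) , (λ j → fan-isGVertex (g j)) ,
    (λ i i′ i≢i′ → fan-distinct (i≢i′ ∘ f-injective)) ,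
    (λ j j′ j≢j′ → fan-distinct (j≢j′ ∘ g-injective)) ,
    (λ i j → fan-distinct (λ fi≡gj →
      ℤ.<-asym (left i) (subst (λ k → t k < - A) (sym fi≡gj) (right j)))) ,
    (λ i j → fan-adjacent (left i) (right j))

-- For r = suc r′ this is A = 4r − 1 and t k = −2(r + k): the first r values lie in
-- (−A, −A/2), the others below −A, and any two of them sum below −A.
module FanParameters (r′ : ℕ) where

  d : ℕ
  d = suc (2 ℕ.* r′)

  A : ℤ
  A = +[1+ d ℕ.+ d ]

  t : ℕ → ℤ
  t k = -[1+ d ℕ.+ 2 ℕ.* k ]

  0<A : 0ℤ < A
  0<A = +<+ (s≤s z≤n)

  t-injective : Injective _≡_ _≡_ t
  t-injective tk≡tl = ℕ.*-cancelˡ-≡ _ _ 2 (ℕ.+-cancelˡ-≡ d _ _ (ℤ.-[1+-injective tk≡tl))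

  t+t<-A : ∀ k l → t k + t l < - A
  t+t<-A k l = -<- (s≤s (ℕ.+-mono-≤ (ℕ.m≤m+n d (2 ℕ.* k)) (ℕ.m≤m+n d (2 ℕ.* l))))

  -A<t : ∀ {k} → k ℕ.< suc r′ → - A < t k
  -A<t k<r = -<- (ℕ.+-monoʳ-< d (s≤s (ℕ.*-monoʳ-≤ 2 (ℕ.≤-pred k<r))))

  t<-A : ∀ {k} → suc r′ ℕ.≤ k → t k < - A
  t<-A {k} r≤k = -<- (ℕ.+-monoʳ-< d (ℕ.<-≤-trans (ℕ.n<1+n d)
                       (subst (ℕ._≤ 2 ℕ.* k) (ℕ.*-suc 2 r′) (ℕ.*-monoʳ-≤ 2 r≤k))))

  sides : ∀ k → - A < t k ⊎ t k < - A
  sides k with k ℕ.<? suc r′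
  ... | yes k<r = inj₁ (-A<t k<r)
  ... | no k≮r  = inj₂ (t<-A (ℕ.≮⇒≥ k≮r))

lemma3 : (r s : ℕ) → r ≥ 1 → s ≥ 1 →
    Σ ℕ λ n → Σ (Fin n → Point) λ P → Σ (Fin n) λ ix →
    Injective _≡_ _≡_ P × GeneralPosition P × ContainsKrs P ix r s
lemma3 zero s () _
lemma3 (suc r′) s _ _ =
  2 ℕ.+ (suc r′ ℕ.+ s) , P , zero , P-injective , P-generalPosition ,
  fan-containsKrs (_↑ˡ s) (suc r′ ↑ʳ_) (Fin.↑ˡ-injective s _ _) (Fin.↑ʳ-injective (suc r′) _ _)
                  left right
  where
  open FanParameters r′
  open Fan A (t ∘ toℕ) 0<A (λ _ → -<+) (Fin.toℕ-injective ∘ t-injective)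
           (λ k l → t+t<-A (toℕ k) (toℕ l)) (sides ∘ toℕ)

  left : ∀ i → - A < t (toℕ (i ↑ˡ s))
  left i = -A<t (subst (ℕ._< suc r′) (sym (Fin.toℕ-↑ˡ i s)) (Fin.toℕ<n i))

  right : ∀ j → t (toℕ (suc r′ ↑ʳ j)) < - A
  right j = t<-A (subst (suc r′ ℕ.≤_) (sym (Fin.toℕ-↑ʳ (suc r′) j)) (ℕ.m≤m+n (suc r′) (toℕ j)))
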